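{- Let $\Gamma$ be a maximal $\mathbb{SKHM}$-consistent set and $\mathcal{M}^c_\Gamma$ its canonical model. Let $\psi,\chi$ be formulas and let $\sigma=a_1\cdots a_n\in\Sigma_\Gamma^*$ be non-empty, where each $a_i$ is $\langle\psi_i,\bot,\phi_i\rangle$ or $\langle\chi_i^{\psi_i},\phi_i\rangle$. Suppose that for every $w\in S^c$ with $\psi\in L(w)$: $\sigma$ is strongly executable at $w$, and $w\xrightarrow{\sigma_j}t'$ implies $\chi\in L(t')$ for all $1\le j<n$. Then $\mathcal{K}hm(\psi,\chi,\phi_i)\in\Gamma$ for all $1\le i\le n$.
   Context: Formulas: $\phi::=p\mid\neg\phi\mid(\phi\wedge\phi)\mid \mathcal{K}hm(\phi,\phi,\phi)$ over countable $\mathbf{P}$; $\mathcal{U}\phi$ abbreviates $\mathcal{K}hm(\neg\phi,\top,\bot)$. The system $\mathbb{SKHM}$ (with $p,q,r,o,p',q',o'$ proposition letters) has axioms: TAUT all propositional tautologies; DISTU $\mathcal{U}p\wedge\mathcal{U}(p\to q)\to\mathcal{U}q$; TU $\mathcal{U}p\to p$; 4KhmU $\mathcal{K}hm(p,o,q)\to\mathcal{U}\mathcal{K}hm(p,o,q)$; 5KhmU $\neg\mathcal{K}hm(p,o,q)\to\mathcal{U}\neg\mathcal{K}hm(p,o,q)$; EMPKhm $\mathcal{U}(p\to q)\to\mathcal{K}hm(p,\bot,q)$; COMPKhm $\mathcal{K}hm(p,o,r)\wedge\mathcal{K}hm(r,o,q)\wedge\mathcal{U}(r\to o)\to\mathcal{K}hm(p,o,q)$;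 ONEKhm $\mathcal{K}hm(p,o,q)\wedge\neg\mathcal{K}hm(p,\bot,q)\to\mathcal{K}hm(p,\bot,o)$; UKhm $\mathcal{U}(p'\to p)\wedge\mathcal{U}(o\to o')\wedge\mathcal{U}(q\to q')\wedge\mathcal{K}hm(p,o,q)\to\mathcal{K}hm(p',o',q')$; rules MP, NECU, SUB. Canonical model: $\Phi_\Gamma$ is the set of maximal consistent $\Delta$ containing exactly the same $\mathcal{K}hm$-formulas as $\Gamma$. $\Sigma_\Gamma=\{\langle\psi,\bot,\phi\rangle\mid\mathcal{K}hm(\psi,\bot,\phi)\in\Gamma\}\cup\{\langle\chi^\psi,\phi\rangle\mid\mathcal{K}hm(\psi,\chi,\phi)\in\Gamma,\ \neg\mathcal{K}hm(\psi,\bot,\phi)\in\Gamma\}$ (formal symbols; $\chi^\psi$ is a formal marker). $S^c$ is the set of pairs $w=(\Delta,\chi^\psi)$ with $\chi\in\Delta\in\Phi_\Gamma$ such that $\langle\chi^\psi,\phi\rangle\in\Sigma_\Gamma$ for some $\phi$ or $\langle\psi,\bot,\chi\rangle\in\Sigma_\Gamma$; $L(w)=\Delta$, $R(w)=\chi^\psi$. Transitions: $w\xrightarrow{\langle\psi,\bot,\phi\rangle}w'$ iff $\psi\in L(w)$ and $R(w')=\phi^\psi$; $w\xrightarrow{\langle\chi^\psi,\phi\rangle}w'$ iff $R(w)=\chi^\psi$ and $\phi\in L(w')$; $p\in V^c(w)$ iff $p\in L(w)$. For $\sigma=a_1\cdots a_n$, $w\xrightarrow{\sigma}t$ means a path labelled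 $a_1,\dots,a_n$; $\sigma_j=a_1\cdots a_j$, $\sigma_0$ empty; $\sigma$ is strongly executable at $w$ if for each $0\le k<n$ every $t$ with $w\xrightarrow{\sigma_k}t$ has an $a_{k+1}$-successor. -}

module Defs where

open import Data.Nat using (ℕ; zero; suc; _<_; _≤_)
open import Data.Bool using (Bool; true; false; not; _∧_)
open import Data.List using (List; []; _∷_; length; take; lookup)
open import Data.List.Relation.Unary.All using (All)
open import Data.Fin using (Fin; fromℕ<)
open import Data.Product using (Σ; _×_; _,_; ∃)
open import Data.Sum using (_⊎_)
open import Data.Empty using (⊥)
open import Relation.Nullary using (¬_)
open import Relation.Binary.PropositionalEquality using (_≡_)
open import Level using (Level; suc; zero)

infixr 6 _∧'_
infixr 5 _⇒_

data Form : Set where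
  var  : ℕ → Form
  ¬'_  : Form → Form
  _∧'_ : Form → Form → Form
  Khm  : Form → Form → Form → Form

⊥' : Form
⊥' = var 0 ∧' (¬' var 0)

⊤' : Form
⊤' = ¬' ⊥'

_⇒_ : Form → Form → Form
φ ⇒ ψ = ¬' (φ ∧' (¬' ψ))

𝒰 : Form → Form
𝒰 φ = Khm (¬' φ) ⊤' ⊥'

-- Propositional tautologies: true under every Boolean valuation of the
-- propositional skeleton (letters and Khm-subformulas are the atoms).

evalB : (Form → Bool) → Form → Bool
evalB v (var n)     = v (var n)
evalB v (¬' φ)      = not (evalB v φ)
evalB v (φ ∧' ψ)    = evalB v φ ∧ evalB v ψ
evalB v (Khm a b c) = v (Khm a b c)

Tautology : Form → Set
Tautology φ = (v : Form → Bool) → evalB v φ ≡ true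

sub : (ℕ → Form) → Form → Form
sub s (var n)     = s n
sub s (¬' φ)      = ¬' sub s φ
sub s (φ ∧' ψ)    = sub s φ ∧' sub s ψ
sub s (Khm a b c) = Khm (sub s a) (sub s b) (sub s c)

p q r o p' q' o' : Form
p  = var 0
q  = var 1
r  = var 2
o  = var 3
p' = var 4
q' = var 5
o' = var 6

infix 2 ⊢_

data ⊢_ : Form → Set where
  TAUT   : ∀ {φ} → Tautology φ → ⊢ φ
  DISTU  : ⊢ (𝒰 p ∧' 𝒰 (p ⇒ q)) ⇒ 𝒰 q
  TU     : ⊢ 𝒰 p ⇒ p
  4KhmU  : ⊢ Khm p o q ⇒ 𝒰 (Khm p o q)
  5KhmU  : ⊢ (¬' Khm p o q) ⇒ 𝒰 (¬' Khm p o q)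
  EMPKhm : ⊢ 𝒰 (p ⇒ q) ⇒ Khm p ⊥' q
  COMPKhm : ⊢ (Khm p o r ∧' (Khm r o q ∧' 𝒰 (r ⇒ o))) ⇒ Khm p o q
  ONEKhm : ⊢ (Khm p o q ∧' (¬' Khm p ⊥' q)) ⇒ Khm p ⊥' o
  UKhm   : ⊢ (𝒰 (p' ⇒ p) ∧' (𝒰 (o ⇒ o') ∧' (𝒰 (q ⇒ q') ∧' Khm p o q)))
               ⇒ Khm p' o' q'
  MP     : ∀ {φ ψ} → ⊢ φ → ⊢ φ ⇒ ψ → ⊢ ψ
  NECU   : ∀ {φ} → ⊢ φ → ⊢ 𝒰 φ
  SUB    : ∀ {φ} (s : ℕ → Form) → ⊢ φ → ⊢ sub s φ

FSet : Set₁
FSet = Form → Set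

_∈_ : Form → FSet → Set
φ ∈ Γ = Γ φ

_∪｛_｝ : FSet → Form → FSet
(Γ ∪｛ φ ｝) ψ = Γ ψ ⊎ (ψ ≡ φ)

⋀ : List Form → Form
⋀ []       = ⊤'
⋀ (φ ∷ φs) = φ ∧' ⋀ φs

Consistent : FSet → Set
Consistent Γ = ¬ (Σ (List Form) λ φs → All (λ φ → φ ∈ Γ) φs × (⊢ ⋀ φs ⇒ ⊥'))

MaxCons : FSet → Set
MaxCons Γ = Consistent Γ × ((φ : Form) → Consistent (Γ ∪｛ φ ｝) → φ ∈ Γ)

module Canonical (Γ : FSet) where

  InΦ : FSet → Set
  InΦ Δ = MaxCons Δ × ((a b c : Form) →
            (Khm a b c ∈ Δ → Khm a b c ∈ Γ) × (Khm a b c ∈ Γ → Khm a b c ∈ Δ))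

  data Label : Set where
    ⟨_,⊥,_⟩  : Form → Form → Label
    ⟨_^_,_⟩  : Form → Form → Form → Label

  record Marker : Set where
    constructor _^_
    field
      base : Form
      sup  : Form

  InΣ : Label → Set
  InΣ ⟨ ψ ,⊥, φ ⟩   = Khm ψ ⊥' φ ∈ Γ
  InΣ ⟨ χ ^ ψ , φ ⟩ = Khm ψ χ φ ∈ Γ × (¬' Khm ψ ⊥' φ) ∈ Γ

  target : Label → Form
  target ⟨ ψ ,⊥, φ ⟩   = φ
  target ⟨ χ ^ ψ , φ ⟩ = φ

  record State : Set₁ where
    field
      L     : FSet
      R     : Marker
      L∈Φ   : InΦ L
      χ∈L   : Marker.base R ∈ L
      ok    : (Σ Form λ φ → InΣ ⟨ Marker.base R ^ Marker.sup R , φ ⟩)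
              ⊎ InΣ ⟨ Marker.sup R ,⊥, Marker.base R ⟩
  open State public

  Step : State → Label → State → Set
  Step w ⟨ ψ ,⊥, φ ⟩   w' = ψ ∈ L w × R w' ≡ (φ ^ ψ)
  Step w ⟨ χ ^ ψ , φ ⟩ w' = R w ≡ (χ ^ ψ) × φ ∈ L w'

  data Path : State → List Label → State → Set₁ where
    nil  : ∀ {w} → Path w [] w
    cons : ∀ {w a u σ t} → Step w a u → Path u σ t → Path w (a ∷ σ) t

  StronglyExecutable : List Label → State → Set₁
  StronglyExecutable σ w =
    (k : ℕ) (k<n : k < length σ) (t : State) → Path w (take k σ) t →
    Σ State λ t' → Step t (lookup σ (fromℕ< k<n)) t'

-- The states reached from ψ-states after k steps of σ always form a class given by one
-- formula C: either all states whose L contains C (initially C = ψ, and C = φᵢ after a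
-- step ⟨χᵢ^ψᵢ,φᵢ⟩), or all states with marker C^A (C = φᵢ, A = ψᵢ after a step ⟨ψᵢ,⊥,φᵢ⟩).
-- Every Φ_Γ-set containing C is the L of some reached state, so strong executability and
-- the condition on intermediate states turn into 𝒰(C → ψᵢ) and 𝒰(C → χ) in Γ, and UKhm
-- and COMPKhm chain the Khm-formulas of the actions into Khm(ψ,χ,φᵢ). A step ⟨χᵢ^ψᵢ,φᵢ⟩
-- cannot follow an unmarked class, since reached states with every marker exist. An empty
-- class C gives Khm(C,⊥,φ) for every φ by EMPKhm. Emptiness is not decidable, but
-- membership in a maximal consistent set is ¬¬-stable.

module Submission where

open import Defs
open import Data.Bool using (Bool; true; false; not; _∧_; T)
open import Data.Bool.Properties using (T-∧; T-≡)
open import Data.Empty using (⊥; ⊥-elim)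
open import Data.Fin using (Fin; toℕ; fromℕ<)
open import Data.Fin.Properties using (toℕ-fromℕ<; fromℕ<-toℕ; toℕ<n)
open import Data.List using (List; []; _∷_; _++_; _∷ʳ_; length; take; lookup; map; cartesianProductWith)
open import Data.List.Properties using (take-suc)
open import Data.List.Membership.Propositional using () renaming (_∈_ to _∈ₗ_)
open import Data.List.Membership.Propositional.Properties
  using (∈-++⁺ˡ; ∈-++⁺ʳ; ∈-map⁺; ∈-cartesianProductWith⁺; ∈-lookup)
open import Data.List.Relation.Unary.All using (All; []; _∷_)
import Data.List.Relation.Unary.All as All
open import Data.List.Relation.Unary.All.Properties using (++⁺)
open import Data.List.Relation.Unary.Any using (here; there)
open import Data.Nat using (ℕ; zero; suc; _<_; _≤_; _<ᵇ_; _⊔_; s≤s; z≤n; _≤′_; ≤′-refl; ≤′-step)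
open import Data.Nat.Properties using (<ᵇ⇒<; ≤-trans; m≤m⊔n; m≤n⊔m; ≤⇒≤′; n≤1+n)
open import Data.Product using (Σ; _×_; _,_; proj₁; proj₂)
open import Data.Sum using (_⊎_; inj₁; inj₂)
open import Function using (_∘_; Equivalence)
open import Relation.Binary.PropositionalEquality using (_≡_; refl; sym; trans; cong; cong₂; subst; subst₂)
open import Relation.Nullary using (¬_)
open import Relation.Nullary.Decidable using (yes; no; ¬¬-excluded-middle)
open import Relation.Unary using (_⊆_)

variable
  A B C D A' B' C' X Y Z φ : Form
  Δ E : FSet

infixr 5 _∷ᵛ_

_∷ᵛ_ : Bool → (ℕ → Bool) → ℕ → Bool
(b ∷ᵛ g) zero    = b
(b ∷ᵛ g) (suc n) = g n

_↾_ : (ℕ → Bool) → ℕ → ℕ → Bool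
g ↾ zero  = λ _ → false
g ↾ suc k = g zero ∷ᵛ (g ∘ suc) ↾ k

↾-agrees : ∀ g {k n} → n < k → (g ↾ k) n ≡ g n
↾-agrees g {suc k} {zero}  _         = refl
↾-agrees g {suc k} {suc n} (s≤s n<k) = ↾-agrees (g ∘ suc) n<k

everyRow : ℕ → ((ℕ → Bool) → Bool) → Bool
everyRow zero    f = f (λ _ → false)
everyRow (suc k) f = everyRow k (f ∘ (true ∷ᵛ_)) ∧ everyRow k (f ∘ (false ∷ᵛ_))

everyRow-sound : ∀ k f → T (everyRow k f) → ∀ g → T (f (g ↾ k))
everyRow-sound zero    f t g = t
everyRow-sound (suc k) f t g with g zero | Equivalence.to T-∧ t
... | true  | t₁ , _  = everyRow-sound k (f ∘ (true ∷ᵛ_))  t₁ (g ∘ suc)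
... | false | _  , t₂ = everyRow-sound k (f ∘ (false ∷ᵛ_)) t₂ (g ∘ suc)

lettersBelow : ℕ → Form → Bool
lettersBelow k (var n)     = n <ᵇ k
lettersBelow k (¬' φ)      = lettersBelow k φ
lettersBelow k (φ ∧' ψ)    = lettersBelow k φ ∧ lettersBelow k ψ
lettersBelow k (Khm _ _ _) = false

letters : (ℕ → Bool) → Form → Bool
letters g (var n) = g n
letters g _       = false

evalB-↾ : ∀ v k φ → T (lettersBelow k φ) → evalB v φ ≡ evalB (letters ((v ∘ var) ↾ k)) φ
evalB-↾ v k (var n)  t = sym (↾-agrees (v ∘ var) (<ᵇ⇒< n k t))
evalB-↾ v k (¬' φ)   t = cong not (evalB-↾ v k φ t)
evalB-↾ v k (φ ∧' ψ) t with Equivalence.to T-∧ t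
... | t₁ , t₂ = cong₂ _∧_ (evalB-↾ v k φ t₁) (evalB-↾ v k ψ t₂)

truthTable : ℕ → Form → Bool
truthTable k φ = lettersBelow k φ ∧ everyRow k (λ g → evalB (letters g) φ)

truthTable-sound : ∀ k φ → T (truthTable k φ) → Tautology φ
truthTable-sound k φ t v with Equivalence.to T-∧ t
... | t₁ , t₂ = trans (evalB-↾ v k φ t₁)
                      (Equivalence.to T-≡ (everyRow-sound k (λ g → evalB (letters g) φ) t₂ (v ∘ var)))

evalB-sub : ∀ v s φ → evalB v (sub s φ) ≡ evalB (evalB v ∘ sub s) φ
evalB-sub v s (var n)     = refl
evalB-sub v s (¬' φ)      = cong not (evalB-sub v s φ)
evalB-sub v s (φ ∧' ψ)    = cong₂ _∧_ (evalB-sub v s φ) (evalB-sub v s ψ)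
evalB-sub v s (Khm a b c) = refl

sub-tautology : ∀ s φ → Tautology φ → Tautology (sub s φ)
sub-tautology s φ t v = trans (evalB-sub v s φ) (t _)

at : List Form → ℕ → Form
at []       n       = var n
at (φ ∷ φs) zero    = φ
at (φ ∷ φs) (suc n) = at φs n

x₁ x₂ x₃ x₄ : Form
x₁ = var 1
x₂ = var 2
x₃ = var 3
x₄ = var 4

-- Tautology schemas are written in the letters x₁ … x₄ and instantiated by
-- the list φs; var 0 is kept fixed, so that ⊥' and ⊤' stay intact.
taut : (φ : Form) (φs : List Form) {_ : T (truthTable 5 φ)} → ⊢ sub (at (var 0 ∷ φs)) φ
taut φ φs {t} = TAUT (sub-tautology (at (var 0 ∷ φs)) φ (truthTable-sound 5 φ t))

infix 2 _⊢ₛ_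

_⊢ₛ_ : FSet → Form → Set
Δ ⊢ₛ φ = Σ (List Form) λ φs → All (_∈ Δ) φs × (⊢ ⋀ φs ⇒ φ)

⊢-trans : ⊢ A ⇒ B → ⊢ B ⇒ C → ⊢ A ⇒ C
⊢-trans {A} {B} {C} d e = MP d (MP e (taut ((x₂ ⇒ x₃) ⇒ ((x₁ ⇒ x₂) ⇒ (x₁ ⇒ x₃))) (A ∷ B ∷ C ∷ [])))

⋀-++ : ∀ xs ys → ⊢ ⋀ (xs ++ ys) ⇒ (⋀ xs ∧' ⋀ ys)
⋀-++ []       ys = taut (x₁ ⇒ (⊤' ∧' x₁)) (⋀ ys ∷ [])
⋀-++ (x ∷ xs) ys = MP (⋀-++ xs ys)
  (taut ((x₂ ⇒ (x₃ ∧' x₄)) ⇒ ((x₁ ∧' x₂) ⇒ ((x₁ ∧' x₃) ∧' x₄))) (x ∷ ⋀ (xs ++ ys) ∷ ⋀ xs ∷ ⋀ ys ∷ []))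

⊢ₛ-theorem : ⊢ A → Δ ⊢ₛ A
⊢ₛ-theorem {A} d = [] , [] , MP d (taut (x₁ ⇒ (⊤' ⇒ x₁)) (A ∷ []))

⊢ₛ-assumption : A ∈ Δ → Δ ⊢ₛ A
⊢ₛ-assumption {A} a = A ∷ [] , a ∷ [] , taut ((x₁ ∧' ⊤') ⇒ x₁) (A ∷ [])

⊢ₛ-mono : Δ ⊢ₛ A → ⊢ A ⇒ B → Δ ⊢ₛ B
⊢ₛ-mono (xs , xs∈ , d) e = xs , xs∈ , ⊢-trans d e

⊢ₛ-∧ : Δ ⊢ₛ A → Δ ⊢ₛ B → Δ ⊢ₛ A ∧' B
⊢ₛ-∧ {A = A} {B = B} (xs , xs∈ , d) (ys , ys∈ , e) = xs ++ ys , ++⁺ xs∈ ys∈ ,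
  ⊢-trans (⋀-++ xs ys) (MP e (MP d
    (taut ((x₁ ⇒ x₃) ⇒ ((x₂ ⇒ x₄) ⇒ ((x₁ ∧' x₂) ⇒ (x₃ ∧' x₄)))) (⋀ xs ∷ ⋀ ys ∷ A ∷ B ∷ []))))

⊢ₛ-mp : Δ ⊢ₛ A → Δ ⊢ₛ A ⇒ B → Δ ⊢ₛ B
⊢ₛ-mp {A = A} {B = B} d e = ⊢ₛ-mono (⊢ₛ-∧ d e) (taut ((x₁ ∧' (x₁ ⇒ x₂)) ⇒ x₂) (A ∷ B ∷ []))

⊢ₛ-deduction : Δ ∪｛ A ｝ ⊢ₛ B → Δ ⊢ₛ A ⇒ B
⊢ₛ-deduction {Δ} {A} {B} (xs , xs∈ , d) =
  ⊢ₛ-mono (⊢ₛ-⋀ xs∈) (MP d (taut ((x₂ ⇒ x₃) ⇒ ((x₁ ⇒ x₂) ⇒ (x₁ ⇒ x₃))) (A ∷ ⋀ xs ∷ B ∷ [])))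
  where
    ⊢ₛ-premise : ∀ {x} → (Δ ∪｛ A ｝) x → Δ ⊢ₛ A ⇒ x
    ⊢ₛ-premise {x} (inj₁ x∈) = ⊢ₛ-mono (⊢ₛ-assumption x∈) (taut (x₁ ⇒ (x₂ ⇒ x₁)) (x ∷ A ∷ []))
    ⊢ₛ-premise (inj₂ refl)   = ⊢ₛ-theorem (taut (x₁ ⇒ x₁) (A ∷ []))

    ⊢ₛ-⋀ : ∀ {ys} → All (Δ ∪｛ A ｝) ys → Δ ⊢ₛ A ⇒ ⋀ ys
    ⊢ₛ-⋀ []                    = ⊢ₛ-theorem (taut (x₁ ⇒ ⊤') (A ∷ []))
    ⊢ₛ-⋀ {y ∷ ys} (y∈ ∷ ys∈) = ⊢ₛ-mono (⊢ₛ-∧ (⊢ₛ-premise y∈) (⊢ₛ-⋀ ys∈))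
      (taut (((x₁ ⇒ x₂) ∧' (x₁ ⇒ x₃)) ⇒ (x₁ ⇒ (x₂ ∧' x₃))) (A ∷ y ∷ ⋀ ys ∷ []))

module MaxConsistent (mc : MaxCons Δ) where

  ⊢ₛ⇒∈ : Δ ⊢ₛ A → A ∈ Δ
  ⊢ₛ⇒∈ d = proj₂ mc _ λ e → proj₁ mc (⊢ₛ-mp d (⊢ₛ-deduction e))

  ∈-stable : ¬ ¬ (A ∈ Δ) → A ∈ Δ
  ∈-stable ¬¬a = proj₂ mc _ λ e → ¬¬a λ a → proj₁ mc (⊢ₛ-mp (⊢ₛ-assumption a) (⊢ₛ-deduction e))

  ¬'-∈ : ¬ (A ∈ Δ) → (¬' A) ∈ Δ
  ¬'-∈ {A} a∉ = proj₂ mc _ λ e →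
    a∉ (⊢ₛ⇒∈ (⊢ₛ-mono (⊢ₛ-deduction e) (taut ((¬' x₁ ⇒ ⊥') ⇒ x₁) (A ∷ []))))

  ¬'-∉ : (¬' A) ∈ Δ → ¬ (A ∈ Δ)
  ¬'-∉ {A} ¬a a = proj₁ mc (⊢ₛ-mp (⊢ₛ-assumption a)
    (⊢ₛ-mono (⊢ₛ-assumption ¬a) (taut (¬' x₁ ⇒ (x₁ ⇒ ⊥')) (A ∷ []))))

  ⊢⇒∈ : ⊢ A → A ∈ Δ
  ⊢⇒∈ = ⊢ₛ⇒∈ ∘ ⊢ₛ-theorem

  ∈-mono : A ∈ Δ → ⊢ A ⇒ B → B ∈ Δ
  ∈-mono a d = ⊢ₛ⇒∈ (⊢ₛ-mono (⊢ₛ-assumption a) d)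

  ∈-∧ : A ∈ Δ → B ∈ Δ → (A ∧' B) ∈ Δ
  ∈-∧ a b = ⊢ₛ⇒∈ (⊢ₛ-∧ (⊢ₛ-assumption a) (⊢ₛ-assumption b))

⊥[_] ⊤[_] : Form → Form
⊥[ A ] = A ∧' ¬' A
⊤[ A ] = ¬' ⊥[ A ]

-- 𝒰 as it occurs in substitution instances of the axioms, where the letter
-- var 0 inside ⊥' and ⊤' is substituted as well.
𝒰[_]_ : Form → Form → Form
𝒰[ A ] X = Khm (¬' X) ⊤[ A ] ⊥[ A ]

sub-cancel : ∀ {s t} → (∀ n → sub s (t n) ≡ var n) → ∀ φ → sub s (sub t φ) ≡ φ
sub-cancel st (var n)  = st n
sub-cancel st (¬' φ)   = cong ¬'_ (sub-cancel st φ)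
sub-cancel st (φ ∧' ψ) = cong₂ _∧'_ (sub-cancel st φ) (sub-cancel st ψ)
sub-cancel st (Khm a b c) =
  cong₂ (λ a' (b' , c') → Khm a' b' c') (sub-cancel st a) (cong₂ _,_ (sub-cancel st b) (sub-cancel st c))

-- Shift all letters up, necessitate, then put A at var 0.
nec[_] : ∀ A {X} → ⊢ X → ⊢ 𝒰[ A ] X
nec[ A ] {X} d = subst (λ Y → ⊢ 𝒰[ A ] Y) (sub-cancel (λ _ → refl) X)
  (SUB (at (A ∷ [])) (NECU (SUB (var ∘ suc) d)))

module Modal {Γ : FSet} (mcΓ : MaxCons Γ) where
  open MaxConsistent mcΓ

  -- Axiom instances: the list given to `at` holds the images of p, q, r, o, p', q', o'.
  Khm-mono[_] : ∀ A {A' C C' B B'} → (𝒰[ A ] (A' ⇒ A)) ∈ Γ → (𝒰[ A ] (C ⇒ C')) ∈ Γ → (𝒰[ A ] (B ⇒ B')) ∈ Γ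
              → Khm A C B ∈ Γ → Khm A' C' B' ∈ Γ
  Khm-mono[ A ] {A'} {C} {C'} {B} {B'} a c b k =
    ∈-mono (∈-∧ a (∈-∧ c (∈-∧ b k))) (SUB (at (A ∷ B ∷ var 2 ∷ C ∷ A' ∷ B' ∷ C' ∷ [])) UKhm)

  -- 𝒰 X is 𝒰[ var 0 ] X.
  𝒰-rebase : ∀ A B {X} → (𝒰[ A ] X) ∈ Γ → (𝒰[ B ] X) ∈ Γ
  𝒰-rebase A B {X} = Khm-mono[ ¬' X ] (⊢⇒∈ (nec[ ¬' X ] (taut (x₁ ⇒ x₁) (¬' X ∷ []))))
                                     (⊢⇒∈ (nec[ ¬' X ] (taut (⊤[ x₁ ] ⇒ ⊤[ x₂ ]) (A ∷ B ∷ []))))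
                                     (⊢⇒∈ (nec[ ¬' X ] (taut (⊥[ x₁ ] ⇒ ⊥[ x₂ ]) (A ∷ B ∷ []))))

  𝒰-nec : ⊢ X → 𝒰 X ∈ Γ
  𝒰-nec = ⊢⇒∈ ∘ NECU

  𝒰-mp : 𝒰 X ∈ Γ → 𝒰 (X ⇒ Y) ∈ Γ → 𝒰 Y ∈ Γ
  𝒰-mp {X = X} {Y = Y} u v = 𝒰-rebase X (var 0) (∈-mono (∈-∧ (𝒰-rebase (var 0) X u) (𝒰-rebase (var 0) X v)) (SUB (at (X ∷ Y ∷ [])) DISTU))

  𝒰-mono : 𝒰 X ∈ Γ → ⊢ X ⇒ Y → 𝒰 Y ∈ Γ
  𝒰-mono u d = 𝒰-mp u (𝒰-nec d)

  𝒰-mono₂ : 𝒰 X ∈ Γ → 𝒰 Y ∈ Γ → ⊢ X ⇒ (Y ⇒ Z) → 𝒰 Z ∈ Γ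
  𝒰-mono₂ u v d = 𝒰-mp v (𝒰-mono u d)

  𝒰-refl : 𝒰 (X ⇒ X) ∈ Γ
  𝒰-refl {X = X} = 𝒰-nec (taut (x₁ ⇒ x₁) (X ∷ []))

  Khm-mono : 𝒰 (A' ⇒ A) ∈ Γ → 𝒰 (C ⇒ C') ∈ Γ → 𝒰 (B ⇒ B') ∈ Γ → Khm A C B ∈ Γ → Khm A' C' B' ∈ Γ
  Khm-mono {A = A} a c b = Khm-mono[ A ] (𝒰-rebase (var 0) A a) (𝒰-rebase (var 0) A c) (𝒰-rebase (var 0) A b)

  Khm-⊥⇒ : Khm A ⊥' B ∈ Γ → Khm A C B ∈ Γ
  Khm-⊥⇒ {C = C} = Khm-mono 𝒰-refl (𝒰-nec (taut (⊥' ⇒ x₁) (C ∷ []))) 𝒰-refl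

  Khm-⊥ : 𝒰 (A ⇒ B) ∈ Γ → Khm A ⊥' B ∈ Γ
  Khm-⊥ {A = A} {B = B} u = Khm-mono 𝒰-refl (𝒰-nec (taut (⊥[ x₁ ] ⇒ ⊥') (A ∷ []))) 𝒰-refl
    (∈-mono (𝒰-rebase (var 0) A u) (SUB (at (A ∷ B ∷ [])) EMPKhm))

  Khm-comp : Khm A C D ∈ Γ → Khm D C B ∈ Γ → 𝒰 (D ⇒ C) ∈ Γ → Khm A C B ∈ Γ
  Khm-comp {A = A} {C = C} {D = D} {B = B} k l u = ∈-mono (∈-∧ k (∈-∧ l (𝒰-rebase (var 0) A u))) (SUB (at (A ∷ B ∷ D ∷ C ∷ [])) COMPKhm)

  Khm-𝒰 : Khm A C B ∈ Γ → 𝒰 (Khm A C B) ∈ Γ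
  Khm-𝒰 {A = A} {C = C} {B = B} k = 𝒰-rebase A (var 0) (∈-mono k (SUB (at (A ∷ B ∷ var 2 ∷ C ∷ [])) 4KhmU))

  ¬Khm-𝒰 : (¬' Khm A C B) ∈ Γ → 𝒰 (¬' Khm A C B) ∈ Γ
  ¬Khm-𝒰 {A = A} {C = C} {B = B} k = 𝒰-rebase A (var 0) (∈-mono k (SUB (at (A ∷ B ∷ var 2 ∷ C ∷ [])) 5KhmU))

rank : Form → ℕ
rank (var n)     = n
rank (¬' φ)      = suc (rank φ)
rank (φ ∧' ψ)    = suc (rank φ ⊔ rank ψ)
rank (Khm a b c) = suc (rank a ⊔ (rank b ⊔ rank c))

formulas≤ : ℕ → List Form
formulas≤ zero    = var zero ∷ []
formulas≤ (suc n) = formulas≤ n ++ var (suc n) ∷ map ¬'_ fs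
  ++ cartesianProductWith _∧'_ fs fs
  ++ cartesianProductWith (λ a (b , c) → Khm a b c) fs (cartesianProductWith _,_ fs fs)
  where fs = formulas≤ n

formulas≤-mono : ∀ {m n} → m ≤ n → φ ∈ₗ formulas≤ m → φ ∈ₗ formulas≤ n
formulas≤-mono m≤n = mono′ (≤⇒≤′ m≤n)
  where
    mono′ : ∀ {m n} → m ≤′ n → φ ∈ₗ formulas≤ m → φ ∈ₗ formulas≤ n
    mono′ ≤′-refl        i = i
    mono′ (≤′-step m≤n) i = ∈-++⁺ˡ (mono′ m≤n i)

∈-formulas≤ : ∀ φ → φ ∈ₗ formulas≤ (rank φ)
∈-formulas≤ (var zero)    = here refl
∈-formulas≤ (var (suc n)) = ∈-++⁺ʳ (formulas≤ n) (here refl)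
∈-formulas≤ (¬' φ) = ∈-++⁺ʳ (formulas≤ (rank φ)) (there (∈-++⁺ˡ (∈-map⁺ ¬'_ (∈-formulas≤ φ))))
∈-formulas≤ (φ ∧' ψ) = ∈-++⁺ʳ (formulas≤ m) (there (∈-++⁺ʳ (map ¬'_ (formulas≤ m)) (∈-++⁺ˡ
    (∈-cartesianProductWith⁺ _∧'_ (formulas≤-mono (m≤m⊔n (rank φ) (rank ψ)) (∈-formulas≤ φ))
                                  (formulas≤-mono (m≤n⊔m (rank φ) (rank ψ)) (∈-formulas≤ ψ))))))
  where m = rank φ ⊔ rank ψ
∈-formulas≤ (Khm a b c) = ∈-++⁺ʳ (formulas≤ m) (there (∈-++⁺ʳ (map ¬'_ (formulas≤ m))
    (∈-++⁺ʳ (cartesianProductWith _∧'_ (formulas≤ m) (formulas≤ m))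
    (∈-cartesianProductWith⁺ _
       (formulas≤-mono (m≤m⊔n (rank a) _) (∈-formulas≤ a))
       (∈-cartesianProductWith⁺ _,_
          (formulas≤-mono (≤-trans (m≤m⊔n (rank b) (rank c)) (m≤n⊔m (rank a) _)) (∈-formulas≤ b))
          (formulas≤-mono (≤-trans (m≤n⊔m (rank b) (rank c)) (m≤n⊔m (rank a) _)) (∈-formulas≤ c)))))))
  where m = rank a ⊔ (rank b ⊔ rank c)

Consistent-⊆ : Δ ⊆ E → Consistent E → Consistent Δ
Consistent-⊆ Δ⊆E con (xs , xs∈ , d) = con (xs , All.map Δ⊆E xs∈ , d)

∪-⊆ : Δ ⊆ E → Δ ∪｛ φ ｝ ⊆ E ∪｛ φ ｝
∪-⊆ Δ⊆E (inj₁ x) = inj₁ (Δ⊆E x)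
∪-⊆ Δ⊆E (inj₂ e) = inj₂ e

addIfConsistent : FSet → Form → FSet
addIfConsistent Δ φ ψ = ψ ∈ Δ ⊎ (ψ ≡ φ × Consistent (Δ ∪｛ φ ｝))

addAllIfConsistent : FSet → List Form → FSet
addAllIfConsistent Δ []       = Δ
addAllIfConsistent Δ (φ ∷ φs) = addAllIfConsistent (addIfConsistent Δ φ) φs

lindenbaumChain : FSet → ℕ → FSet
lindenbaumChain Δ zero    = Δ
lindenbaumChain Δ (suc n) = addAllIfConsistent (lindenbaumChain Δ n) (formulas≤ n)

lindenbaumLimit : FSet → FSet
lindenbaumLimit Δ φ = Σ ℕ λ n → φ ∈ lindenbaumChain Δ n

chain⊆limit : ∀ n → lindenbaumChain Δ n ⊆ lindenbaumLimit Δ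
chain⊆limit n x = n , x

⊆-addAll : ∀ φs → Δ ⊆ addAllIfConsistent Δ φs
⊆-addAll []       x = x
⊆-addAll (φ ∷ φs) x = ⊆-addAll φs (inj₁ x)

lindenbaumChain-mono : ∀ {m n} → m ≤ n → lindenbaumChain Δ m ⊆ lindenbaumChain Δ n
lindenbaumChain-mono m≤n = mono′ (≤⇒≤′ m≤n)
  where
    mono′ : ∀ {m n} → m ≤′ n → lindenbaumChain Δ m ⊆ lindenbaumChain Δ n
    mono′ ≤′-refl                   x = x
    mono′ {n = suc n} (≤′-step m≤n) x = ⊆-addAll (formulas≤ n) (mono′ m≤n x)

All-addIfConsistent : ∀ {xs} → All (addIfConsistent Δ φ) xs → All (_∈ Δ) xs ⊎ Consistent (Δ ∪｛ φ ｝)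
All-addIfConsistent []                    = inj₁ []
All-addIfConsistent (inj₂ (_ , con) ∷ _)  = inj₂ con
All-addIfConsistent (inj₁ x ∷ xs∈) with All-addIfConsistent xs∈
... | inj₁ xs∈Δ = inj₁ (x ∷ xs∈Δ)
... | inj₂ con  = inj₂ con

addIfConsistent⊆∪ : addIfConsistent Δ φ ⊆ Δ ∪｛ φ ｝
addIfConsistent⊆∪ (inj₁ x)       = inj₁ x
addIfConsistent⊆∪ (inj₂ (e , _)) = inj₂ e

Consistent-add : Consistent Δ → Consistent (addIfConsistent Δ φ)
Consistent-add con (xs , xs∈ , d) with All-addIfConsistent xs∈
... | inj₁ xs∈Δ = con (xs , xs∈Δ , d)
... | inj₂ con′ = con′ (xs , All.map addIfConsistent⊆∪ xs∈ , d)

Consistent-addAll : ∀ φs → Consistent Δ → Consistent (addAllIfConsistent Δ φs)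
Consistent-addAll []       con = con
Consistent-addAll (φ ∷ φs) con = Consistent-addAll φs (Consistent-add con)

Consistent-lindenbaumChain : ∀ n → Consistent Δ → Consistent (lindenbaumChain Δ n)
Consistent-lindenbaumChain zero    con = con
Consistent-lindenbaumChain (suc n) con = Consistent-addAll (formulas≤ n) (Consistent-lindenbaumChain n con)

All-lindenbaumLimit : ∀ {xs} → All (lindenbaumLimit Δ) xs → Σ ℕ λ N → All (_∈ lindenbaumChain Δ N) xs
All-lindenbaumLimit []                = 0 , []
All-lindenbaumLimit ((n , x) ∷ xs∈) with All-lindenbaumLimit xs∈
... | N , xs∈N = n ⊔ N , lindenbaumChain-mono (m≤m⊔n n N) x
                       ∷ All.map (lindenbaumChain-mono (m≤n⊔m n N)) xs∈N

Consistent-lindenbaumLimit : Consistent Δ → Consistent (lindenbaumLimit Δ)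
Consistent-lindenbaumLimit con (xs , xs∈ , d) with All-lindenbaumLimit xs∈
... | N , xs∈N = Consistent-lindenbaumChain N con (xs , xs∈N , d)

addAll-maximal : ∀ φs → φ ∈ₗ φs → Consistent (addAllIfConsistent Δ φs ∪｛ φ ｝) → φ ∈ addAllIfConsistent Δ φs
addAll-maximal {Δ = Δ} (φ ∷ φs) (here refl) con =
  ⊆-addAll φs (inj₂ (refl , Consistent-⊆ (∪-⊆ λ {ψ} → ⊆-addAll φs {ψ} ∘ inj₁) con))
addAll-maximal (ψ ∷ φs) (there i) con = addAll-maximal φs i con

lindenbaumLimit-maximal : ∀ φ → Consistent (lindenbaumLimit Δ ∪｛ φ ｝) → φ ∈ lindenbaumLimit Δ
lindenbaumLimit-maximal {Δ} φ con = suc (rank φ) ,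
  addAll-maximal (formulas≤ (rank φ)) (∈-formulas≤ φ) (Consistent-⊆ (∪-⊆ λ {ψ} → chain⊆limit (suc (rank φ)) {ψ}) con)

lindenbaum : Consistent Δ → Σ FSet λ Δ⁺ → MaxCons Δ⁺ × Δ ⊆ Δ⁺
lindenbaum con = lindenbaumLimit _ , (Consistent-lindenbaumLimit con , lindenbaumLimit-maximal) , λ {ψ} → chain⊆limit 0 {ψ}

take-suc-fromℕ< : ∀ {S : Set} (xs : List S) {k} (k<n : k < length xs)
                → take (suc k) xs ≡ take k xs ∷ʳ lookup xs (fromℕ< k<n)
take-suc-fromℕ< xs k<n = subst (λ m → take (suc m) xs ≡ take m xs ∷ʳ lookup xs (fromℕ< k<n))
                               (toℕ-fromℕ< k<n) (take-suc xs (fromℕ< k<n))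

module _ {Γ : FSet} where
  open Canonical Γ

  Path-∷ʳ⁺ : ∀ {w s t a xs} → Path w xs s → Step s a t → Path w (xs ∷ʳ a) t
  Path-∷ʳ⁺ nil        st = cons st nil
  Path-∷ʳ⁺ (cons x p) st = cons x (Path-∷ʳ⁺ p st)

  Path-∷ʳ⁻ : ∀ {w t a} xs → Path w (xs ∷ʳ a) t → Σ State λ s → Path w xs s × Step s a t
  Path-∷ʳ⁻ []       (cons st nil) = _ , nil , st
  Path-∷ʳ⁻ (x ∷ xs) (cons st p) with Path-∷ʳ⁻ xs p
  ... | s , q , st′ = s , cons st q , st′

module CanonicalModel {Γ : FSet} (mcΓ : MaxCons Γ) where
  open MaxConsistent mcΓ
  open Modal mcΓ
  open Canonical Γ

  data KhmLiteral : Form → Set where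
    khm  : ∀ a b c → KhmLiteral (Khm a b c)
    ¬khm : ∀ a b c → KhmLiteral (¬' Khm a b c)

  𝒰-literal : KhmLiteral φ → φ ∈ Γ → 𝒰 φ ∈ Γ
  𝒰-literal (khm a b c)  = Khm-𝒰
  𝒰-literal (¬khm a b c) = ¬Khm-𝒰

  InΦ-literals : MaxCons Δ → (∀ {φ} → KhmLiteral φ → φ ∈ Γ → φ ∈ Δ) → InΦ Δ
  InΦ-literals mcΔ lit = mcΔ , λ a b c →
    (λ k∈Δ → ∈-stable λ k∉Γ → MaxConsistent.¬'-∉ mcΔ (lit (¬khm a b c) (¬'-∈ k∉Γ)) k∈Δ) ,
    lit (khm a b c)

  𝒰-⋀ : ∀ {xs} → All (λ x → 𝒰 (A ⇒ x) ∈ Γ) xs → 𝒰 (A ⇒ ⋀ xs) ∈ Γ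
  𝒰-⋀ {A} []                = 𝒰-nec (taut (x₁ ⇒ ⊤') (A ∷ []))
  𝒰-⋀ {A} {x ∷ xs} (u ∷ us) =
    𝒰-mono₂ u (𝒰-⋀ us) (taut ((x₁ ⇒ x₂) ⇒ ((x₁ ⇒ x₃) ⇒ (x₁ ⇒ (x₂ ∧' x₃)))) (A ∷ x ∷ ⋀ xs ∷ []))

  𝒰-derivation : ∀ {xs} → All (λ x → 𝒰 (A ⇒ x) ∈ Γ) xs → ⊢ ⋀ xs ⇒ B → 𝒰 (A ⇒ B) ∈ Γ
  𝒰-derivation {A} {B} {xs} us d =
    𝒰-mono₂ (𝒰-nec d) (𝒰-⋀ us) (taut ((x₂ ⇒ x₃) ⇒ ((x₁ ⇒ x₂) ⇒ (x₁ ⇒ x₃))) (A ∷ ⋀ xs ∷ B ∷ []))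

  -- The canonical 𝒰-lemma: a Φ_Γ-set containing A but not B is obtained by
  -- extending {A, ¬B} together with the Khm-literals of Γ.
  𝒰-fromΦ : (∀ Δ → InΦ Δ → A ∈ Δ → B ∈ Δ) → 𝒰 (A ⇒ B) ∈ Γ
  𝒰-fromΦ {A} {B} h = ∈-stable λ u∉Γ → refute (lindenbaum (counterexample-consistent u∉Γ))
    where
      Counterexample : FSet
      Counterexample φ = φ ≡ A ⊎ φ ≡ ¬' B ⊎ (KhmLiteral φ × φ ∈ Γ)

      𝒰-counterexample : ∀ {x} → Counterexample x → 𝒰 ((A ∧' ¬' B) ⇒ x) ∈ Γ
      𝒰-counterexample (inj₁ refl)               = 𝒰-nec (taut ((x₁ ∧' ¬' x₂) ⇒ x₁) (A ∷ B ∷ []))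
      𝒰-counterexample (inj₂ (inj₁ refl))        = 𝒰-nec (taut ((x₁ ∧' ¬' x₂) ⇒ ¬' x₂) (A ∷ B ∷ []))
      𝒰-counterexample {x} (inj₂ (inj₂ (l , x∈))) =
        𝒰-mono (𝒰-literal l x∈) (taut (x₂ ⇒ (x₁ ⇒ x₂)) ((A ∧' ¬' B) ∷ x ∷ []))

      counterexample-consistent : ¬ (𝒰 (A ⇒ B) ∈ Γ) → Consistent Counterexample
      counterexample-consistent u∉Γ (xs , xs∈ , d) = u∉Γ (𝒰-mono (𝒰-derivation (All.map 𝒰-counterexample xs∈) d)
        (taut (((x₁ ∧' ¬' x₂) ⇒ ⊥') ⇒ (x₁ ⇒ x₂)) (A ∷ B ∷ [])))

      refute : (Σ FSet λ Δ → MaxCons Δ × Counterexample ⊆ Δ) → ⊥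
      refute (Δ , mcΔ , ⊆Δ) = MaxConsistent.¬'-∉ mcΔ (⊆Δ (inj₂ (inj₁ refl)))
        (h Δ (InΦ-literals mcΔ (λ l x∈ → ⊆Δ (inj₂ (inj₂ (l , x∈))))) (⊆Δ (inj₁ refl)))

  ⊤-state : ∀ Δ → InΦ Δ → Form → State
  ⊤-state Δ Δ∈Φ A = record
    { L = Δ ; R = ⊤' ^ A ; L∈Φ = Δ∈Φ ; χ∈L = MaxConsistent.⊢⇒∈ (proj₁ Δ∈Φ) (taut ⊤' [])
    ; ok = inj₂ (Khm-⊥ (𝒰-nec (taut (x₁ ⇒ ⊤') (A ∷ [])))) }

  marked-state : ∀ {Δ} → InΦ Δ → C ∈ Δ → Khm A ⊥' C ∈ Γ → State
  marked-state {C = C} {A = A} {Δ = Δ} Δ∈Φ c k = record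
    { L = Δ ; R = C ^ A ; L∈Φ = Δ∈Φ ; χ∈L = c ; ok = inj₂ k }

module Stages {Γ : FSet} (mcΓ : MaxCons Γ) (ψ χ : Form)
  (σ : List (Canonical.Label Γ)) (σ⊆Σ : All (Canonical.InΣ Γ) σ)
  (H : (w : Canonical.State Γ) → ψ ∈ Canonical.L w
       → Canonical.StronglyExecutable Γ σ w
         × ((j : ℕ) → 1 ≤ j → j < length σ → (t' : Canonical.State Γ)
             → Canonical.Path Γ w (take j σ) t' → χ ∈ Canonical.L t')) where

  open MaxConsistent mcΓ
  open Modal mcΓ
  open CanonicalModel mcΓ
  open Canonical Γ

  n : ℕ
  n = length σ

  act : ∀ {k} → k < n → Label
  act k<n = lookup σ (fromℕ< k<n)

  Reach : ℕ → State → Set₁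
  Reach k t = Σ State λ w → ψ ∈ L w × Path w (take k σ) t

  reach-χ : ∀ {k t} → 1 ≤ k → k < n → Reach k t → χ ∈ L t
  reach-χ 1≤k k<n (w , ψ∈w , p) = proj₂ (H w ψ∈w) _ 1≤k k<n _ p

  module AtStep {k} (k<n : k < n) {a} (act≡a : act k<n ≡ a) where

    take-suc-act : take (suc k) σ ≡ take k σ ∷ʳ a
    take-suc-act = subst (λ b → take (suc k) σ ≡ take k σ ∷ʳ b) act≡a (take-suc-fromℕ< σ k<n)

    a∈Σ : InΣ a
    a∈Σ = subst InΣ act≡a (All.lookup σ⊆Σ (∈-lookup (fromℕ< k<n)))

    executable : ∀ {t} → Reach k t → Σ State (Step t a)
    executable (w , ψ∈w , p) = subst (λ b → Σ State (Step _ b)) act≡a (proj₁ (H w ψ∈w) k k<n _ p)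

    reach-step : ∀ {t u} → Reach k t → Step t a u → Reach (suc k) u
    reach-step (w , ψ∈w , p) st = w , ψ∈w , subst (λ xs → Path w xs _) (sym take-suc-act) (Path-∷ʳ⁺ p st)

    reach-step⁻ : ∀ {u} → Reach (suc k) u → Σ State λ t → Reach k t × Step t a u
    reach-step⁻ (w , ψ∈w , p) with Path-∷ʳ⁻ (take k σ) (subst (λ xs → Path w xs _) take-suc-act p)
    ... | t , q , st = t , (w , ψ∈w , q) , st

  Leads : Form → Set
  Leads C = ∀ φ → Khm C χ φ ∈ Γ → Khm ψ χ φ ∈ Γ

  leads-via : Khm ψ χ C ∈ Γ → 𝒰 (C ⇒ χ) ∈ Γ → Leads C
  leads-via K u φ k = Khm-comp K k u

  data Shape (k : ℕ) (C : Form) : Set₁ where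
    unmarked : (∀ t → C ∈ L t → Reach k t) → Shape k C
    marked   : ∀ A → Khm A ⊥' C ∈ Γ → (∀ φ → Khm A C φ ∈ Γ → Khm ψ χ φ ∈ Γ)
             → (∀ t → R t ≡ (C ^ A) → Reach k t) → (∀ t → Reach k t → R t ≡ (C ^ A))
             → Shape k C

  record Stage (k : ℕ) : Set₁ where
    field
      class   : Form
      leads   : Leads class
      reached : ∀ t → Reach k t → class ∈ L t
      shape   : Shape k class

  Realised : ℕ → Form → Set₁
  Realised k C = ∀ Δ → InΦ Δ → C ∈ Δ → Σ State λ t → Reach k t × L t ≡ Δ

  realised-unmarked : ∀ {k} → (∀ t → C ∈ L t → Reach k t) → Realised k C
  realised-unmarked cover Δ Δ∈Φ c = ⊤-state Δ Δ∈Φ ψ , cover _ c , refl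

  realised-marked : ∀ {k} → Khm A ⊥' C ∈ Γ → (∀ t → R t ≡ (C ^ A) → Reach k t) → Realised k C
  realised-marked K cover Δ Δ∈Φ c = marked-state Δ∈Φ c K , cover _ refl , refl

  realised : ∀ {k} → Shape k C → Realised k C
  realised (unmarked cover)         = realised-unmarked cover
  realised (marked _ K _ cover _) = realised-marked K cover

  𝒰-reached : ∀ {k} → Realised k C → (∀ t → Reach k t → A ∈ L t) → 𝒰 (C ⇒ A) ∈ Γ
  𝒰-reached {A = A} real h = 𝒰-fromΦ λ Δ Δ∈Φ c →
    let t , r , L≡Δ = real Δ Δ∈Φ c in subst (A ∈_) L≡Δ (h t r)

  Inhabited : Form → Set₁
  Inhabited C = Σ FSet λ Δ → InΦ Δ × C ∈ Δ

  Done : Set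
  Done = ∀ φ → Khm ψ χ φ ∈ Γ

  uninhabited⇒done : Leads C → ¬ Inhabited C → Done
  uninhabited⇒done lead ¬inh φ = lead φ (Khm-⊥⇒ (Khm-⊥ (𝒰-fromΦ λ Δ Δ∈Φ c → ⊥-elim (¬inh (Δ , Δ∈Φ , c)))))

  Outcome : ℕ → Form → Set₁
  Outcome k φ = Khm ψ χ φ ∈ Γ × (suc k < n → Stage (suc k))

  advance-⊥ : ∀ {A φ k} (s : Stage k) (k<n : k < n) → act k<n ≡ ⟨ A ,⊥, φ ⟩
            → Inhabited (Stage.class s) → Outcome k φ
  advance-⊥ {A} {φ} {k} s k<n act≡a (Δ , Δ∈Φ , c) = K , next
    where
      open Stage s
      open AtStep k<n act≡a
      t₀ = realised shape Δ Δ∈Φ c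
      r₀ = proj₁ (proj₂ t₀)

      𝒰class⇒A : 𝒰 (class ⇒ A) ∈ Γ
      𝒰class⇒A = 𝒰-reached (realised shape) λ t r → proj₁ (proj₂ (executable r))

      K : Khm ψ χ φ ∈ Γ
      K = leads φ (Khm-⊥⇒ (Khm-mono 𝒰class⇒A 𝒰-refl 𝒰-refl a∈Σ))

      cover : ∀ t → R t ≡ (φ ^ A) → Reach (suc k) t
      cover t R≡ = reach-step r₀ (proj₁ (proj₂ (executable r₀)) , R≡)

      back : ∀ t → Reach (suc k) t → R t ≡ (φ ^ A)
      back t r = proj₂ (proj₂ (proj₂ (reach-step⁻ r)))

      next : suc k < n → Stage (suc k)
      next sk<n = record
        { class   = φ
        ; leads   = leads-via K 𝒰φ⇒χ
        ; reached = λ t r → subst (λ m → Marker.base m ∈ L t) (back t r) (χ∈L t)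
        ; shape   = marked A a∈Σ (λ φ′ k → leads φ′ (Khm-mono 𝒰class⇒A 𝒰φ⇒χ 𝒰-refl k)) cover back
        }
        where
          𝒰φ⇒χ : 𝒰 (φ ⇒ χ) ∈ Γ
          𝒰φ⇒χ = 𝒰-reached (realised-marked a∈Σ cover) λ t → reach-χ (s≤s z≤n) sk<n

  -- Reached states with the distinct markers ⊤' ^ var 0 and ⊤' ^ var 1 exist,
  -- while an action ⟨ C ^ A , φ ⟩ is only executable at states with marker C ^ A.
  unmarked-stuck : ∀ {C A φ B k} (k<n : k < n) → act k<n ≡ ⟨ C ^ A , φ ⟩
                 → (∀ t → B ∈ L t → Reach k t) → ¬ Inhabited B
  unmarked-stuck {C} {A} k<n act≡a cover (Δ , Δ∈Φ , b) = ⊤^0≢⊤^1 (trans (marker (var 0)) (sym (marker (var 1))))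
    where
      open AtStep k<n act≡a
      marker : ∀ x → (⊤' ^ x) ≡ (C ^ A)
      marker x = proj₁ (proj₂ (executable (cover (⊤-state Δ Δ∈Φ x) b)))

      ⊤^0≢⊤^1 : ¬ (⊤' ^ var 0) ≡ (⊤' ^ var 1)
      ⊤^0≢⊤^1 ()

  ^-injective : ∀ {C A C′ A′} → (C ^ A) ≡ (C′ ^ A′) → C ≡ C′ × A ≡ A′
  ^-injective refl = refl , refl

  advance-^ : ∀ {C A φ k} (s : Stage k) (k<n : k < n) → act k<n ≡ ⟨ C ^ A , φ ⟩
            → Inhabited (Stage.class s) → Outcome k φ
  advance-^ {C} {A} {φ} {k} s k<n act≡a inh@(Δ , Δ∈Φ , c) with Stage.shape s
  ... | unmarked cover = ⊥-elim (unmarked-stuck k<n act≡a cover inh)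
  ... | marked A′ K′ prefix cover back = K , next
    where
      open AtStep k<n act≡a
      r₀ = proj₁ (proj₂ (realised-marked K′ cover Δ Δ∈Φ c))
      R≡ = proj₁ (proj₂ (executable r₀))
      same = ^-injective (trans (sym (back _ r₀)) R≡)

      K : Khm ψ χ φ ∈ Γ
      K = prefix φ (subst₂ (λ x y → Khm x y φ ∈ Γ) (sym (proj₂ same)) (sym (proj₁ same)) (proj₁ a∈Σ))

      cover′ : ∀ t → φ ∈ L t → Reach (suc k) t
      cover′ t φ∈ = reach-step r₀ (R≡ , φ∈)

      next : suc k < n → Stage (suc k)
      next sk<n = record
        { class   = φ
        ; leads   = leads-via K (𝒰-reached (realised-unmarked cover′) λ t → reach-χ (s≤s z≤n) sk<n)
        ; reached = λ t r → proj₂ (proj₂ (proj₂ (reach-step⁻ r)))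
        ; shape   = unmarked cover′
        }

  advance : ∀ {k} (s : Stage k) (k<n : k < n) → Inhabited (Stage.class s) → Outcome _ (target (act k<n))
  advance s k<n inh with act k<n in act≡a
  ... | ⟨ A ,⊥, φ ⟩   = advance-⊥ s k<n act≡a inh
  ... | ⟨ C ^ A , φ ⟩ = advance-^ s k<n act≡a inh

  advance-or-done : ∀ {k} → Stage k → (k<n : k < n) → ¬ ¬ (Outcome _ (target (act k<n)) ⊎ Done)
  advance-or-done s k<n ¬goal = ¬¬-excluded-middle λ where
    (yes inh) → ¬goal (inj₁ (advance s k<n inh))
    (no ¬inh) → ¬goal (inj₂ (uninhabited⇒done (Stage.leads s) ¬inh))

  initial : Stage 0
  initial = record
    { class   = ψ
    ; leads   = λ _ K → K
    ; reached = λ { t (w , ψ∈w , nil) → ψ∈w }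
    ; shape   = unmarked λ t ψ∈t → t , ψ∈t , nil
    }

  stage-or-done : ∀ k → k < n → ¬ ¬ (Stage k ⊎ Done)
  stage-or-done zero    _    ¬goal = ¬goal (inj₁ initial)
  stage-or-done (suc k) sk<n ¬goal = stage-or-done k k<n λ where
      (inj₁ s)    → advance-or-done s k<n λ where
        (inj₁ (_ , next)) → ¬goal (inj₁ (next sk<n))
        (inj₂ done)       → ¬goal (inj₂ done)
      (inj₂ done) → ¬goal (inj₂ done)
    where k<n = ≤-trans (n≤1+n (suc k)) sk<n

  Khm-target : ∀ {k} (k<n : k < n) → Khm ψ χ (target (act k<n)) ∈ Γ
  Khm-target k<n = ∈-stable λ ¬K → stage-or-done _ k<n λ where
    (inj₁ s)    → advance-or-done s k<n λ where
      (inj₁ (K , _)) → ¬K K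
      (inj₂ done)    → ¬K (done _)
    (inj₂ done) → ¬K (done _)

proposition12 : (Γ : FSet) → MaxCons Γ → (ψ χ : Form)
    → (σ : List (Canonical.Label Γ)) → All (Canonical.InΣ Γ) σ → ¬ (σ ≡ [])
    → ((w : Canonical.State Γ) → ψ ∈ Canonical.L w
        → Canonical.StronglyExecutable Γ σ w
          × ((j : ℕ) → 1 ≤ j → j < length σ → (t' : Canonical.State Γ)
              → Canonical.Path Γ w (take j σ) t' → χ ∈ Canonical.L t'))
    → (i : Fin (length σ)) → Khm ψ χ (Canonical.target Γ (lookup σ i)) ∈ Γ
-- The hypothesis σ ≢ [] is implied by the existence of i.
proposition12 Γ mcΓ ψ χ σ σ⊆Σ _ H i =
  subst (λ j → Khm ψ χ (Canonical.target Γ (lookup σ j)) ∈ Γ) (fromℕ<-toℕ i (toℕ<n i))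
    (Stages.Khm-target mcΓ ψ χ σ σ⊆Σ H (toℕ<n i))
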